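{- Let $N\ge1$, and let $[q_1,q_2,u]$ be a triple with $q_2\mid q_1\mid N$ and $u\in(\mathbb Z/\gcd(\frac N{q_1},\frac{q_1}{q_2})\mathbb Z)^*$. Then $[q_1,q_2,u]$ belongs to $V_{\Gamma_0(N)}$, i.e. is of the form $\big[\frac{N}{\gcd(d,N/d)},\frac{N/d}{\gcd(d,N/d)},u\big]$ for some divisor $d$ of $N$, if and only if for every prime $p\mid N$, either $\mathrm{ord}_p(\frac N{q_1})=\mathrm{ord}_p(\frac{q_1}{q_2})$, or ($\mathrm{ord}_p(\frac N{q_1})\le\mathrm{ord}_p(\frac{q_1}{q_2})$ and $\mathrm{ord}_p(q_2)=0$).
   Context: $\mathrm{ord}_p$ denotes the $p$-adic valuation. The triples $[q_1,q_2,u]$ parametrise the orbits of $\Gamma_0(N)$ acting on $(\mathbb Z/N\mathbb Z)^2$ by right multiplication, via $(x,y)\mapsto[\gcd(x,N),\gcd(y,\gcd(x,N)),\frac{x}{q_1}\frac{y}{q_2}\bmod\gcd(\frac N{q_1},\frac{q_1}{q_2})]$; $V_{\Gamma_0(N)}$ is the set of triples $\big[\frac{N}{\gcd(d,N/d)},\frac{N/d}{\gcd(d,N/d)},u\big]$ with $d\mid N$ and $u\in(\mathbb Z/\gcd(d,N/d)\mathbb Z)^*$. -}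

module Defs where

open import Data.Nat using (ℕ; suc; _*_; _^_; _≤_; _<_)
open import Data.Nat.Divisibility using (_∣_; quotient)
open import Data.Nat.GCD using (gcd)
open import Data.Nat.Coprimality using (Coprime)
open import Data.Nat.Primality using (Prime)
open import Data.Product using (Σ; _×_)
open import Data.Sum using (_⊎_)
open import Relation.Binary.PropositionalEquality using (_≡_)
open import Relation.Nullary using (¬_)

IsOrd : ℕ → ℕ → ℕ → Set
IsOrd p n k = (p ^ k ∣ n) × ¬ (p ^ suc k ∣ n)

IsUnitMod : ℕ → ℕ → Set
IsUnitMod m u = (u < m) × Coprime u m

-- [q1,q2,u] ∈ V_{Γ0(N)} : there is d ∣ N, with g = gcd(d, N/d), such that
-- q1 = N/g, q2 = (N/d)/g (written as q1 * g = N, q2 * g = N/d; g ≠ 0 since N ≥ 1)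
-- and u ∈ (ℤ/gℤ)^*.
InV : (N q1 q2 u : ℕ) → Set
InV N q1 q2 u =
  Σ ℕ λ d → Σ (d ∣ N) λ d∣N →
    let e = quotient d∣N
        g = gcd d e
    in (q1 * g ≡ N) × (q2 * g ≡ e) × IsUnitMod g u

-- the local condition at all primes p ∣ N, for a = N/q1, b = q1/q2, c = q2
LocalCondition : (N a b c : ℕ) → Set
LocalCondition N a b c =
  (p : ℕ) → Prime p → p ∣ N →
  (i j k : ℕ) → IsOrd p a i → IsOrd p b j → IsOrd p c k →
  (i ≡ j) ⊎ ((i ≤ j) × (k ≡ 0))

module Submission where

-- Write a = N/q1, b = q1/q2 and c = q2, so that N = c·a·b.
--
-- In a triple [N/g, (N/d)/g, u] with g = gcd(d, N/d) the
-- equations q1·g = N and q2·g = N/d force g = a, N/d = c·a and hence d = b.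
-- So [q1,q2,u] ∈ V_{Γ0(N)} iff a = gcd(b, c·a); the unit condition on u is
-- then the hypothesis itself, since a ∣ b gives gcd(a, b) = a.
--
-- Local step.  "a = gcd(b, c·a)" is checked prime by prime.  With
-- i, j, k the p-adic valuations of a, b, c it reads min(j, k + i) = i, i.e.
-- i = j, or i ≤ j and k = 0: exactly the local condition of the theorem.
-- Going from the local statement back to divisibilities uses that x ∣ y as
-- soon as every prime power dividing x divides y (x ≠ 0), proved from the
-- prime factorisation of x.

open import Defs
open import Data.Nat using (ℕ; _≤_)
open import Data.Nat.Divisibility using (_∣_; quotient)
open import Data.Nat.GCD using (gcd)
open import Data.Product using (_×_)
open import Function.Bundles using (_⇔_)

open import Data.Nat.Base using (zero; suc; _*_; _^_; _<_; NonZero; >-nonZero; z≤n; s≤s)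
open import Data.Nat.Properties
  using (_≟_; *-comm; *-assoc; *-identityʳ; *-cancelˡ-≡; ≤-trans; ≤-refl; _≤?_; ≰⇒>; ≤∧≢⇒<;
         m*n≢0; m*n≢0⇒n≢0)
open import Data.Nat.Divisibility
  using (divides; _∣?_; ∣-trans; 1∣_; ∣-refl; m∣m*n; n∣m*n; m*n∣⇒m∣;
         *-monoʳ-∣; *-pres-∣; *-cancelˡ-∣; quotient-<; quotient≢0; quotient-∣)
open import Data.Nat.GCD using (GCD; gcd-GCD)
open import Data.Nat.Primality
  using (Prime; ¬prime[1]; euclidsLemma; prime⇒irreducible; prime⇒nonZero; prime⇒nonTrivial)
open import Data.Nat.Primality.Factorisation using (factorise; PrimeFactorisation)
open import Data.Nat.Induction using (<-rec)
open import Data.Nat.ListAction using (product)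
open import Data.Nat.Tactic.RingSolver using (solve-∀)
open import Data.List.Base using (_∷_)
open import Data.List.Relation.Unary.All using (All; []; _∷_)
open import Data.Product using (Σ; _,_; proj₁; proj₂)
open import Data.Sum using (_⊎_; inj₁; inj₂)
open import Function.Base using (_∘_)
open import Function.Bundles using (mk⇔)
open import Relation.Nullary using (¬_; yes; no; contradiction)
open import Relation.Binary.PropositionalEquality using (_≡_; _≢_; refl; sym; trans; cong; subst; subst₂)
open Relation.Binary.PropositionalEquality.≡-Reasoning

^-monoʳ-∣ : ∀ p {m n} → m ≤ n → p ^ m ∣ p ^ n
^-monoʳ-∣ p {n = n} z≤n   = 1∣ (p ^ n)
^-monoʳ-∣ p       (s≤s m≤n) = *-monoʳ-∣ p (^-monoʳ-∣ p m≤n)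

*p-shift-∣ : ∀ p {k q} → p ^ k ∣ q → p ^ suc k ∣ q * p
*p-shift-∣ p {k} {q} pᵏ∣q = subst (p ^ suc k ∣_) (*-comm p q) (*-monoʳ-∣ p pᵏ∣q)

*p-unshift-∣ : ∀ p {k q} .{{_ : NonZero p}} → p ^ suc k ∣ q * p → p ^ k ∣ q
*p-unshift-∣ p {k} {q} pᵏ⁺¹∣qp = *-cancelˡ-∣ p (subst (p ^ suc k ∣_) (*-comm q p) pᵏ⁺¹∣qp)

ord-bound : ∀ p {x} k m → IsOrd p x k → p ^ m ∣ x → m ≤ k
ord-bound p k m (_ , pᵏ⁺¹∤x) pᵐ∣x with m ≤? k
... | yes m≤k = m≤k
... | no  m≰k = contradiction (∣-trans (^-monoʳ-∣ p (≰⇒> m≰k)) pᵐ∣x) pᵏ⁺¹∤x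

ord-divides : ∀ p {x} k m → IsOrd p x k → m ≤ k → p ^ m ∣ x
ord-divides p k m (pᵏ∣x , _) m≤k = ∣-trans (^-monoʳ-∣ p m≤k) pᵏ∣x

∣-nonZero : ∀ {m n} .{{_ : NonZero n}} → m ∣ n → NonZero m
∣-nonZero {{n≢0}} (divides q n≡q*m) = m*n≢0⇒n≢0 q {{subst NonZero n≡q*m n≢0}}

valuation : ∀ {p} → Prime p → ∀ n → .{{NonZero n}} → Σ ℕ (IsOrd p n)
valuation {p} pr n {{n≢0}} = <-rec Valuation step n n≢0
  where
  instance
    p≢0 : NonZero p
    p≢0 = prime⇒nonZero pr
  Valuation : ℕ → Set
  Valuation n = .(NonZero n) → Σ ℕ (IsOrd p n)
  step : ∀ n → (∀ {m} → m < n → Valuation m) → Valuation n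
  step n rec n≢0 with p ∣? n
  ... | no p∤n = 0 , 1∣ n , p∤n ∘ subst (_∣ n) (*-identityʳ p)
  ... | yes p∣n@(divides q n≡q*p)
    with rec (quotient-< p∣n {{prime⇒nonTrivial pr}} {{n≢0}}) (quotient≢0 p∣n {{n≢0}})
  ...   | k , pᵏ∣q , pᵏ⁺¹∤q =
    suc k , subst (p ^ suc k ∣_) (sym n≡q*p) (*p-shift-∣ p {k} pᵏ∣q)
          , pᵏ⁺¹∤q ∘ *p-unshift-∣ p {suc k} ∘ subst (p ^ suc (suc k) ∣_) n≡q*p

prime^-∣-cancel : ∀ {p c} → Prime p → ¬ p ∣ c → ∀ k {x} → p ^ k ∣ c * x → p ^ k ∣ x
prime^-∣-cancel pr p∤c zero {x} _ = 1∣ x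
prime^-∣-cancel {p} {c} pr p∤c (suc k) {x} pᵏ⁺¹∣cx
  with euclidsLemma c x pr (m*n∣⇒m∣ p (p ^ k) pᵏ⁺¹∣cx)
... | inj₁ p∣c = contradiction p∣c p∤c
... | inj₂ (divides x′ refl) =
  *p-shift-∣ p {k} (prime^-∣-cancel pr p∤c k (*p-unshift-∣ p {k} pᵏ⁺¹∣cx′p))
  where
  instance
    p≢0 : NonZero p
    p≢0 = prime⇒nonZero pr
  pᵏ⁺¹∣cx′p : p ^ suc k ∣ c * x′ * p
  pᵏ⁺¹∣cx′p = subst (p ^ suc k ∣_) (sym (*-assoc c x′ p)) pᵏ⁺¹∣cx

prime∤prime : ∀ {q p} → Prime q → Prime p → q ≢ p → ¬ q ∣ p
prime∤prime prq prp q≢p q∣p with prime⇒irreducible prp q∣p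
... | inj₁ refl = contradiction prq ¬prime[1]
... | inj₂ q≡p  = q≢p q≡p

PrimePowersDivide : ℕ → ℕ → Set
PrimePowersDivide x y = ∀ q k → Prime q → q ^ k ∣ x → q ^ k ∣ y

local-prime-∣ : ∀ {x y p} → PrimePowersDivide x y → Prime p → p ∣ x → p ∣ y
local-prime-∣ {p = p} local prp p∣x =
  subst (_∣ _) (*-identityʳ p) (local p 1 prp (subst (_∣ _) (sym (*-identityʳ p)) p∣x))

-- For a product of primes, local divisibility implies divisibility: peel off
-- the first prime p from y = y′·p; the remaining prime powers still divide y′
-- (for q = p by cancelling p, for q ≠ p by Euclid's lemma).
product-∣ : ∀ {ps} → All Prime ps → ∀ {y} → PrimePowersDivide (product ps) y → product ps ∣ y
product-∣ []                 {y} _     = 1∣ y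
product-∣ {p ∷ ps} (prp ∷ prs) {y} local
  with local-prime-∣ local prp (m∣m*n (product ps))
... | divides y′ refl =
  subst (p * product ps ∣_) (*-comm p y′) (*-monoʳ-∣ p (product-∣ prs local′))
  where
  instance
    p≢0 : NonZero p
    p≢0 = prime⇒nonZero prp
  local′ : PrimePowersDivide (product ps) y′
  local′ q k prq qᵏ∣Πps with q ≟ p
  ... | yes refl = *p-unshift-∣ p {k} (local p (suc k) prp (*-monoʳ-∣ p qᵏ∣Πps))
  ... | no  q≢p  = prime^-∣-cancel prq (prime∤prime prq prp q≢p) k
                     (subst (q ^ k ∣_) (*-comm y′ p) (local q k prq (∣-trans qᵏ∣Πps (n∣m*n p))))

local⇒∣ : ∀ x {y} .{{_ : NonZero x}} → PrimePowersDivide x y → x ∣ y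
local⇒∣ x {y} local = subst (_∣ y) (sym x≡Πps)
  (product-∣ factorsPrime λ q k prq qᵏ∣Πps → local q k prq (subst (q ^ k ∣_) (sym x≡Πps) qᵏ∣Πps))
  where
  open PrimeFactorisation (factorise x)
  x≡Πps : x ≡ product factors
  x≡Πps = isFactorisation

ord-mono-∣ : ∀ p {a b} i j → IsOrd p a i → IsOrd p b j → a ∣ b → i ≤ j
ord-mono-∣ p i j (pⁱ∣a , _) ob a∣b = ord-bound p j i ob (∣-trans pⁱ∣a a∣b)

LocalConditionAt : ℕ → ℕ → ℕ → ℕ → Set
LocalConditionAt p a b c = (i j k : ℕ) → IsOrd p a i → IsOrd p b j → IsOrd p c k →
  (i ≡ j) ⊎ ((i ≤ j) × (k ≡ 0))

-- Global ⇒ local: if i < j and p ∣ c, then p^(i+1) divides both b and c·a,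
-- hence divides their gcd a, contradicting ord_p a = i.
gcd⇒local : ∀ {a b c} → GCD b (c * a) a → ∀ p → LocalConditionAt p a b c
gcd⇒local {a} {b} {c} G p i j k oa ob oc with i ≟ j | k
... | yes i≡j | _      = inj₁ i≡j
... | no  _   | zero   = inj₂ (ord-mono-∣ p i j oa ob (GCD.gcd∣m G) , refl)
... | no  i≢j | suc k′ = contradiction (GCD.greatest G (pⁱ⁺¹∣b , pⁱ⁺¹∣ca)) (proj₂ oa)
  where
  pⁱ⁺¹∣b : p ^ suc i ∣ b
  pⁱ⁺¹∣b = ord-divides p j (suc i) ob (≤∧≢⇒< (ord-mono-∣ p i j oa ob (GCD.gcd∣m G)) i≢j)
  pⁱ⁺¹∣ca : p ^ suc i ∣ c * a
  pⁱ⁺¹∣ca = *-pres-∣ (m*n∣⇒m∣ p (p ^ k′) (proj₁ oc)) (proj₁ oa)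

local-≤ : ∀ {i j k : ℕ} → (i ≡ j) ⊎ ((i ≤ j) × (k ≡ 0)) → i ≤ j
local-≤ (inj₁ refl)     = ≤-refl
local-≤ (inj₂ (i≤j , _)) = i≤j

ord≡0⇒∤ : ∀ {p c} → IsOrd p c 0 → ¬ p ∣ c
ord≡0⇒∤ {p} (_ , p¹∤c) = p¹∤c ∘ subst (_∣ _) (sym (*-identityʳ p))

module _ {a b c : ℕ} .{{_ : NonZero a}} .{{_ : NonZero b}} .{{_ : NonZero c}} where

  local-a∣b : ∀ q m → Prime q → LocalConditionAt q a b c → q ^ m ∣ a → q ^ m ∣ b
  local-a∣b q m prq lc qᵐ∣a
    with (i , oa) ← valuation prq a | (j , ob) ← valuation prq b | (k , oc) ← valuation prq c
    = ord-divides q j m ob (≤-trans (ord-bound q i m oa qᵐ∣a) (local-≤ (lc i j k oa ob oc)))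

  -- ... and a prime power dividing b and c·a divides a: if i = j it is
  -- bounded by ord_q b, otherwise q ∤ c and it can be cancelled from c·a.
  local-greatest : ∀ q m → Prime q → LocalConditionAt q a b c →
    q ^ m ∣ b → q ^ m ∣ c * a → q ^ m ∣ a
  local-greatest q m prq lc qᵐ∣b qᵐ∣ca
    with (i , oa) ← valuation prq a | (j , ob) ← valuation prq b | (k , oc) ← valuation prq c
    with lc i j k oa ob oc
  ... | inj₁ refl       = ord-divides q i m oa (ord-bound q j m ob qᵐ∣b)
  ... | inj₂ (_ , refl) = prime^-∣-cancel prq (ord≡0⇒∤ oc) m qᵐ∣ca

  local⇒gcd : ∀ {N} → a ∣ N → b ∣ N → LocalCondition N a b c → GCD b (c * a) a
  local⇒gcd {N} a∣N b∣N lc = record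
    { commonDivisor = local⇒∣ a (atPrimesOf a∣N local-a∣b) , n∣m*n c
    ; greatest      = greatest
    }
    where
    -- a non-trivial prime power dividing a divisor of N sits at a prime q ∣ N
    atPrimesOf : ∀ {x y} → x ∣ N →
      (∀ q k → Prime q → LocalConditionAt q a b c → q ^ k ∣ x → q ^ k ∣ y) →
      PrimePowersDivide x y
    atPrimesOf x∣N h q zero    prq _    = 1∣ _
    atPrimesOf x∣N h q (suc k) prq qᵏ∣x =
      h q (suc k) prq (lc q prq (∣-trans (m*n∣⇒m∣ q (q ^ k) qᵏ∣x) x∣N)) qᵏ∣x

    greatest : ∀ {d} → d ∣ b × d ∣ c * a → d ∣ a
    greatest (d∣b , d∣ca) = local⇒∣ _ {{∣-nonZero d∣b}} (atPrimesOf (∣-trans d∣b b∣N)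
      λ q k prq lcq qᵏ∣d → local-greatest q k prq lcq (∣-trans qᵏ∣d d∣b) (∣-trans qᵏ∣d d∣ca))

level-factorisation : ∀ {N q1} a b q2 → N ≡ a * q1 → q1 ≡ b * q2 → N ≡ q2 * a * b
level-factorisation a b q2 refl refl = rearrange a b q2
  where
  rearrange : ∀ a b c → a * (b * c) ≡ c * a * b
  rearrange = solve-∀

-- A witness d of membership is forced: q1·g = N = q1·a gives g = a, then
-- N/d = q2·g = q2·a, and N = (N/d)·d = (q2·a)·b gives d = b.
inV⇒gcd : ∀ {N a b q1 q2 u} .{{_ : NonZero q1}} .{{_ : NonZero (q2 * a)}} →
  N ≡ a * q1 → q1 ≡ b * q2 → InV N q1 q2 u → GCD b (q2 * a) a
inV⇒gcd {N} {a} {b} {q1} {q2} N≡aq1 q1≡bq2 (d , divides e N≡ed , q1g≡N , q2g≡e , _) =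
  subst₂ (λ x y → GCD x y a) d≡b e≡q2a (subst (GCD d e) g≡a (gcd-GCD d e))
  where
  g≡a : gcd d e ≡ a
  g≡a = *-cancelˡ-≡ (gcd d e) a q1 (trans q1g≡N (trans N≡aq1 (*-comm a q1)))
  e≡q2a : e ≡ q2 * a
  e≡q2a = trans (sym q2g≡e) (cong (q2 *_) g≡a)
  d≡b : d ≡ b
  d≡b = *-cancelˡ-≡ d b (q2 * a) (begin
    q2 * a * d ≡⟨ cong (_* d) e≡q2a ⟨
    e * d      ≡⟨ N≡ed ⟨
    N          ≡⟨ level-factorisation a b q2 N≡aq1 q1≡bq2 ⟩
    q2 * a * b ∎)

-- Conversely, if a = gcd(b, q2·a) then d = b is a witness; since a ∣ b also
-- gcd(a, b) = a, so the unit u modulo gcd(a, b) is a unit modulo g.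
gcd⇒inV : ∀ {N a b q1 q2 u} → N ≡ a * q1 → q1 ≡ b * q2 →
  IsUnitMod (gcd a b) u → GCD b (q2 * a) a → InV N q1 q2 u
gcd⇒inV {N} {a} {b} {q1} {q2} {u} N≡aq1 q1≡bq2 unit G =
  b , divides (q2 * a) (level-factorisation a b q2 N≡aq1 q1≡bq2) , q1g≡N , cong (q2 *_) g≡a ,
  subst (λ g → IsUnitMod g u) (trans gcd[a,b]≡a (sym g≡a)) unit
  where
  g≡a : gcd b (q2 * a) ≡ a
  g≡a = GCD.unique (gcd-GCD b (q2 * a)) G
  gcd[a,b]≡a : gcd a b ≡ a
  gcd[a,b]≡a = GCD.unique (gcd-GCD a b) (GCD.is (∣-refl , GCD.gcd∣m G) proj₁)
  q1g≡N : q1 * gcd b (q2 * a) ≡ N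
  q1g≡N = begin
    q1 * gcd b (q2 * a) ≡⟨ cong (q1 *_) g≡a ⟩
    q1 * a              ≡⟨ *-comm q1 a ⟩
    a * q1              ≡⟨ N≡aq1 ⟨
    N                   ∎

mainTheorem11 : (N : ℕ) → 1 ≤ N → (q1 q2 u : ℕ) →
    (q1∣N : q1 ∣ N) → (q2∣q1 : q2 ∣ q1) →
    IsUnitMod (gcd (quotient q1∣N) (quotient q2∣q1)) u →
    InV N q1 q2 u ⇔ LocalCondition N (quotient q1∣N) (quotient q2∣q1) q2
mainTheorem11 N 1≤N q1 q2 u q1∣N@(divides a N≡aq1) q2∣q1@(divides b q1≡bq2) unit =
  mk⇔ (λ inV p _ _ → gcd⇒local (inV⇒gcd N≡aq1 q1≡bq2 inV) p)
      (gcd⇒inV N≡aq1 q1≡bq2 unit ∘ local⇒gcd a∣N b∣N)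
  where
  instance
    N≢0 : NonZero N
    N≢0 = >-nonZero 1≤N
    q1≢0 : NonZero q1
    q1≢0 = ∣-nonZero q1∣N
    a≢0 : NonZero a
    a≢0 = quotient≢0 q1∣N
    q2≢0 : NonZero q2
    q2≢0 = ∣-nonZero q2∣q1
    b≢0 : NonZero b
    b≢0 = quotient≢0 q2∣q1
    q2a≢0 : NonZero (q2 * a)
    q2a≢0 = m*n≢0 q2 a
  a∣N : a ∣ N
  a∣N = quotient-∣ q1∣N
  b∣N : b ∣ N
  b∣N = ∣-trans (quotient-∣ q2∣q1) q1∣N
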